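{- Let $A\in\mathbb{R}^{n\times n}$ be a symmetric matrix with nonnegative entries. Then \[ \rho_{\mathrm{per}}(A)+\eta_{\mathrm{per}}(A)=n . \]
   Context: For an $m\times m$ matrix $B$, $\mathrm{per}(B)=\sum_{\sigma\in S_m}\prod_i b_{i,\sigma(i)}$. The permanental rank $\rho_{\mathrm{per}}(A)$ is the largest integer $k$ such that $A$ has a $k\times k$ submatrix $A[I,J]$ (rows $I$, columns $J$, $|I|=|J|=k$) with nonzero permanent. The permanental nullity $\eta_{\mathrm{per}}(A)$ is the multiplicity of $0$ as a root of the permanental polynomial $\pi(A,x)=\mathrm{per}(A-xI)$. -}

module Defs where

open import Level using (0ℓ)
open import Data.Nat as ℕ using (ℕ; zero; suc)
open import Data.Fin using (Fin; zero; suc; _≟_)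
open import Data.Fin.Properties using (all?)
open import Data.List using (List; []; _∷_; [_]; map; concatMap; filter; foldr)
open import Data.Product using (Σ; _×_; _,_; ∃; ∃-syntax)
open import Relation.Binary.PropositionalEquality using (_≡_; _≢_)
open import Relation.Binary.Structures using (IsTotalOrder)
open import Relation.Nullary using (Dec; ¬_)
open import Relation.Nullary.Decidable using (_→-dec_)
open import Algebra.Structures using (IsCommutativeRing)

-- The real numbers, axiomatised as a complete ordered field
-- (all models are isomorphic to ℝ).  Equality is propositional.

record RealField : Set₁ where
  infixl 6 _+_
  infixl 7 _*_
  infix 4 _≤_ _<_
  field
    ℝ   : Set
    _+_ _*_ : ℝ → ℝ → ℝ
    -_  : ℝ → ℝ
    0# 1# : ℝ
    _≤_ : ℝ → ℝ → Set
    isCommutativeRing : IsCommutativeRing _≡_ _+_ _*_ -_ 0# 1#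
    0≢1 : 0# ≢ 1#
    inverse : ∀ x → x ≢ 0# → ∃[ y ] (x * y ≡ 1#)
    isTotalOrder : IsTotalOrder _≡_ _≤_
    +-mono-≤ : ∀ {x y} z → x ≤ y → x + z ≤ y + z
    *-nonneg : ∀ {x y} → 0# ≤ x → 0# ≤ y → 0# ≤ x * y
    complete : (S : ℝ → Set) → ∃[ s ] S s → ∃[ b ] (∀ x → S x → x ≤ b) →
               ∃[ u ] ((∀ x → S x → x ≤ u) × (∀ b → (∀ x → S x → x ≤ b) → u ≤ b))

  _<_ : ℝ → ℝ → Set
  x < y = x ≤ y × x ≢ y

allFuns : (m k : ℕ) → List (Fin k → Fin m)
allFuns m zero    = [ (λ ()) ]
allFuns m (suc k) = concatMap (λ f → map (λ j → cons j f) (allFin' m)) (allFuns m k)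
  where
  allFin' : (m : ℕ) → List (Fin m)
  allFin' zero    = []
  allFin' (suc m) = zero ∷ map suc (allFin' m)
  cons : Fin m → (Fin k → Fin m) → Fin (suc k) → Fin m
  cons j f zero    = j
  cons j f (suc i) = f i

IsInjective : ∀ {k m} → (Fin k → Fin m) → Set
IsInjective σ = ∀ i j → σ i ≡ σ j → i ≡ j

injective? : ∀ {k m} (σ : Fin k → Fin m) → Dec (IsInjective σ)
injective? σ = all? (λ i → all? (λ j → (σ i ≟ σ j) →-dec (i ≟ j)))

permutations : (m : ℕ) → List (Fin m → Fin m)
permutations m = filter injective? (allFuns m m)

module _ {C : Set} (_⊕_ _⊗_ : C → C → C) (𝟘 𝟙 : C) where

  prodFin : (k : ℕ) → (Fin k → C) → C
  prodFin zero    f = 𝟙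
  prodFin (suc k) f = f zero ⊗ prodFin k (λ i → f (suc i))

  perWith : (m : ℕ) → (Fin m → Fin m → C) → C
  perWith m B = foldr _⊕_ 𝟘 (map (λ σ → prodFin m (λ i → B i (σ i))) (permutations m))

module OverReals (Rf : RealField) where
  open RealField Rf

  Matrix : ℕ → Set
  Matrix n = Fin n → Fin n → ℝ

  per : (m : ℕ) → (Fin m → Fin m → ℝ) → ℝ
  per = perWith _+_ _*_ 0# 1#

  Symmetric : ∀ {n} → Matrix n → Set
  Symmetric A = ∀ i j → A i j ≡ A j i

  Nonnegative : ∀ {n} → Matrix n → Set
  Nonnegative A = ∀ i j → 0# ≤ A i j

  -- a k-subset of {1..n}, listed increasingly
  StrictlyIncreasing : ∀ {k n} → (Fin k → Fin n) → Set
  StrictlyIncreasing {k} f = ∀ (i j : Fin k) → i Data.Fin.< j → f i Data.Fin.< f j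

  sub : ∀ {n k} → Matrix n → (Fin k → Fin n) → (Fin k → Fin n) → Fin k → Fin k → ℝ
  sub A I J a b = A (I a) (J b)

  IsPermRank : ∀ {n} → Matrix n → ℕ → Set
  IsPermRank {n} A k =
    (Σ (Fin k → Fin n) λ I → Σ (Fin k → Fin n) λ J →
       StrictlyIncreasing I × StrictlyIncreasing J × per k (sub A I J) ≢ 0#)
    × (∀ k' → k ℕ.< k' → (I J : Fin k' → Fin n) →
         StrictlyIncreasing I → StrictlyIncreasing J → per k' (sub A I J) ≡ 0#)

  -- Polynomials in x over ℝ as coefficient lists (constant term first).
  Poly : Set
  Poly = List ℝ

  _+ₚ_ : Poly → Poly → Poly
  []       +ₚ q        = q
  (a ∷ p)  +ₚ []       = a ∷ p
  (a ∷ p)  +ₚ (b ∷ q)  = (a + b) ∷ (p +ₚ q)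

  scale : ℝ → Poly → Poly
  scale c = map (c *_)

  _*ₚ_ : Poly → Poly → Poly
  []      *ₚ q = []
  (a ∷ p) *ₚ q = scale a q +ₚ (0# ∷ (p *ₚ q))

  coeff : Poly → ℕ → ℝ
  coeff []      _       = 0#
  coeff (a ∷ p) zero    = a
  coeff (a ∷ p) (suc k) = coeff p k

  A-xI : ∀ {n} → Matrix n → Fin n → Fin n → Poly
  A-xI A i j with i ≟ j
  ... | Relation.Nullary.yes _ = A i j ∷ (- 1#) ∷ []
  ... | Relation.Nullary.no  _ = A i j ∷ []

  permPoly : ∀ {n} → Matrix n → Poly
  permPoly {n} A = perWith _+ₚ_ _*ₚ_ [] (1# ∷ []) n (A-xI A)

  -- η_per(A) = e : 0 is a root of π(A,x) of multiplicity exactly e,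
  -- i.e. x^e divides π(A,x) but x^(e+1) does not.
  IsPermNullity : ∀ {n} → Matrix n → ℕ → Set
  IsPermNullity A e =
    (∀ k → k ℕ.< e → coeff (permPoly A) k ≡ 0#) × coeff (permPoly A) e ≢ 0#

module Submission where

-- For a permutation σ, expanding ∏ᵢ (A i (σ i) − x·[σ i = i]) shows that (−1)^k times the
-- coefficient of x^k in per(A − xI) is a sum of nonnegative terms, one for each permutation σ
-- and k-set T of fixed points of σ such that A i (σ i) ≠ 0 off T.  So that coefficient is
-- nonzero iff the complement of T is covered by the cycles of some σ running along nonzero
-- entries of A; η is the least |T| with such a cover.  A cover of the complement of T makes
-- the principal permanent on that complement nonzero, so n − η ≤ ρ.  Conversely, a nonzero
-- ρ × ρ permanent yields a partial injection along the nonzero entries defined on ρ points.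
-- As A is symmetric, the last arrow x ↦ y of a path that dead-ends at y can be turned into the
-- 2-cycle x ↔ y (dropping the arrow into x); this keeps ρ points in the domain and puts one
-- more vertex on a 2-cycle, so iterating gives a cycle cover of at least ρ vertices and
-- ρ ≤ n − η.  Equality of reals is undecidable, so both inequalities hold under double
-- negation, which the decidable equation of naturals then discharges.

open import Defs
open import Level using (0ℓ)
open import Algebra.Bundles using (CommutativeRing)
import Algebra.Properties.Ring as RingProperties
open import Effect.Monad using (RawMonad)
open import Function using (_∘_)
open import Data.Bool using (Bool; true; false; not)
open import Data.Bool.Properties using (not-injective)
open import Data.Empty using (⊥-elim)
open import Data.Fin using (Fin; zero; suc; _≟_)
open import Data.Fin.Properties using (any?)
open import Data.List using (List; []; _∷_; map; foldr; _++_)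
open import Data.List.Membership.Propositional using (_∈_)
open import Data.List.Membership.Propositional.Properties
  using (∈-map⁺; ∈-concatMap⁺; ∈-filter⁺; ∈-filter⁻)
open import Data.List.Relation.Unary.Any using (here; there)
import Data.List.Relation.Unary.Any as Any
open import Data.Maybe using (Maybe; just; nothing; is-nothing; fromMaybe)
open import Data.Maybe.Properties using (just-injective) renaming (≡-dec to ≡-dec-Maybe)
open import Data.Nat using (ℕ; zero; suc)
import Data.Nat as ℕ
import Data.Nat.Properties as ℕ
open import Data.Product using (Σ; ∃-syntax; _×_; _,_; proj₁; proj₂)
open import Data.Sum using (_⊎_; inj₁; inj₂)
open import Data.Vec.Functional using (tail)
import Data.Vec.Functional as Vec
open import Relation.Binary.PropositionalEquality
  using (_≡_; _≢_; refl; sym; trans; cong; cong₂; subst; subst₂; module ≡-Reasoning)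
open import Relation.Binary.Structures using (IsTotalOrder)
open import Relation.Nullary using (¬_; Dec; yes; no; does)
open import Relation.Nullary.Decidable
  using (_×-dec_; dec-true; dec-false; decidable-stable; ¬¬-excluded-middle)
open import Relation.Nullary.Negation using (¬¬-Monad)

open RawMonad (¬¬-Monad {0ℓ}) using (pure; _>>=_; _<$>_)

module Counting where
  open import Data.Nat using (_+_; _≤_; _<_; z≤n; s≤s)
  open import Data.Nat.Properties using (+-suc; ≤-trans; <-≤-trans; m≤n+m; m≤m+n)
  import Data.Fin as F
  open import Data.Fin.Properties using (<-cmp; <-irrefl; injective⇒≤)
  open import Relation.Binary.Definitions using (tri<; tri≈; tri>)

  count : ∀ {n} → (Fin n → Bool) → ℕ
  count {zero}  P = 0
  count {suc n} P with P zero
  ... | true  = suc (count (tail P))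
  ... | false = count (tail P)

  _⊆_ : ∀ {n} → (Fin n → Bool) → (Fin n → Bool) → Set
  P ⊆ Q = ∀ u → P u ≡ true → Q u ≡ true

  count-complement : ∀ {n} (P : Fin n → Bool) → count P + count (not ∘ P) ≡ n
  count-complement {zero}  P = refl
  count-complement {suc n} P with P zero
  ... | true  = cong suc (count-complement (tail P))
  ... | false = trans (+-suc (count (tail P)) _) (cong suc (count-complement (tail P)))

  count-≤ : ∀ {n} (P : Fin n → Bool) → count P ≤ n
  count-≤ P = subst (count P ≤_) (count-complement P) (m≤m+n _ _)

  count-mono : ∀ {n} {P Q : Fin n → Bool} → P ⊆ Q → count P ≤ count Q
  count-mono {zero}              P⊆Q = z≤n
  count-mono {suc n} {P} {Q} P⊆Q with P zero in P0 | Q zero in Q0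
  ... | false | false = count-mono (P⊆Q ∘ suc)
  ... | false | true  = ≤-trans (count-mono (P⊆Q ∘ suc)) (m≤n+m _ 1)
  ... | true  | true  = s≤s (count-mono (P⊆Q ∘ suc))
  ... | true  | false with () ← trans (sym (P⊆Q zero P0)) Q0

  count-mono-< : ∀ {n} {P Q : Fin n → Bool} → P ⊆ Q →
    ∀ x → P x ≡ false → Q x ≡ true → count P < count Q
  count-mono-< {suc n} {P} {Q} P⊆Q zero Px Qx rewrite Px | Qx = s≤s (count-mono (P⊆Q ∘ suc))
  count-mono-< {suc n} {P} {Q} P⊆Q (suc x) Px Qx with P zero in P0 | Q zero in Q0
  ... | false | false = count-mono-< (P⊆Q ∘ suc) x Px Qx
  ... | false | true  = <-≤-trans (count-mono-< (P⊆Q ∘ suc) x Px Qx) (m≤n+m _ 1)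
  ... | true  | true  = s≤s (count-mono-< (P⊆Q ∘ suc) x Px Qx)
  ... | true  | false with () ← trans (sym (P⊆Q zero P0)) Q0

  strictlyIncreasing⇒injective : ∀ {k n} {f : Fin k → Fin n} →
    (∀ i j → i F.< j → f i F.< f j) → IsInjective f
  strictlyIncreasing⇒injective {f = f} inc i j fi≡fj with <-cmp i j
  ... | tri< i<j _ _ = ⊥-elim (<-irrefl fi≡fj (inc i j i<j))
  ... | tri≈ _ i≡j _ = i≡j
  ... | tri> _ _ j<i = ⊥-elim (<-irrefl (sym fi≡fj) (inc j i j<i))

  enum : ∀ {n} (P : Fin n → Bool) → Fin (count P) → Fin n
  enum {suc n} P a with P zero
  enum {suc n} P zero    | true  = zero
  enum {suc n} P (suc a) | true  = suc (enum (tail P) a)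
  enum {suc n} P a       | false = suc (enum (tail P) a)

  enum-∈ : ∀ {n} (P : Fin n → Bool) a → P (enum P a) ≡ true
  enum-∈ {suc n} P a with P zero in P0
  enum-∈ {suc n} P zero    | true  = P0
  enum-∈ {suc n} P (suc a) | true  = enum-∈ (tail P) a
  enum-∈ {suc n} P a       | false = enum-∈ (tail P) a

  enum-strictlyIncreasing : ∀ {n} (P : Fin n → Bool) a b → a F.< b → enum P a F.< enum P b
  enum-strictlyIncreasing {suc n} P a b a<b with P zero
  enum-strictlyIncreasing {suc n} P zero    (suc b) a<b       | true  = s≤s z≤n
  enum-strictlyIncreasing {suc n} P (suc a) (suc b) (s≤s a<b) | true  =
    s≤s (enum-strictlyIncreasing (tail P) a b a<b)
  enum-strictlyIncreasing {suc n} P a       b       a<b       | false =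
    s≤s (enum-strictlyIncreasing (tail P) a b a<b)

  enum-injective : ∀ {n} (P : Fin n → Bool) → IsInjective (enum P)
  enum-injective P = strictlyIncreasing⇒injective (enum-strictlyIncreasing P)

  enum-surjective : ∀ {n} (P : Fin n → Bool) u → P u ≡ true → ∃[ a ] enum P a ≡ u
  enum-surjective {suc n} P u Pu with P zero in P0
  enum-surjective {suc n} P zero    Pu | true  = zero , refl
  enum-surjective {suc n} P (suc u) Pu | true  with a , refl ← enum-surjective (tail P) u Pu = suc a , refl
  enum-surjective {suc n} P (suc u) Pu | false with a , refl ← enum-surjective (tail P) u Pu = a , refl
  enum-surjective {suc n} P zero    Pu | false with () ← trans (sym P0) Pu

  injection⇒≤count : ∀ {r n} (P : Fin n → Bool) (g : Fin r → Fin n) → IsInjective g →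
    (∀ a → P (g a) ≡ true) → r ≤ count P
  injection⇒≤count {r} P g g-inj g∈P = injective⇒≤ {f = index} index-injective
    where
    index : Fin r → Fin (count P)
    index a = proj₁ (enum-surjective P (g a) (g∈P a))
    index-injective : ∀ {a b} → index a ≡ index b → a ≡ b
    index-injective {a} {b} eq = g-inj a b (begin
      g a             ≡⟨ sym (proj₂ (enum-surjective P (g a) (g∈P a))) ⟩
      enum P (index a) ≡⟨ cong (enum P) eq ⟩
      enum P (index b) ≡⟨ proj₂ (enum-surjective P (g b) (g∈P b)) ⟩
      g b             ∎)
      where open ≡-Reasoning

open Counting

-- Defs enumerates Fin m by a function local to allFuns; unification recovers it from allFuns m 1.
private
  finEnumeration : Σ ((m : ℕ) → List (Fin m)) λ F → Σ ((m : ℕ) → Fin m → Fin 1 → Fin m) λ C →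
                   ∀ m → allFuns m 1 ≡ map (C m) (F m) ++ []
  finEnumeration = _ , _ , λ _ → refl

  allFin′ : (m : ℕ) → List (Fin m)
  allFin′ = proj₁ finEnumeration

  ∈-allFin′ : ∀ {m} (j : Fin m) → j ∈ allFin′ m
  ∈-allFin′ zero    = here refl
  ∈-allFin′ (suc j) = there (∈-map⁺ suc (∈-allFin′ j))

allFuns-complete : ∀ m k (f : Fin k → Fin m) → ∃[ f′ ] f′ ∈ allFuns m k × (∀ i → f′ i ≡ f i)
allFuns-complete m zero    f = (λ ()) , here refl , λ ()
allFuns-complete m (suc k) f with f′ , f′∈ , f′≗f ← allFuns-complete m k (f ∘ suc) =
  _ ,
  ∈-concatMap⁺ _ (Any.map (λ { refl → ∈-map⁺ _ (∈-allFin′ (f zero)) }) f′∈) ,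
  λ { zero → refl ; (suc i) → f′≗f i }

permutations-injective : ∀ {m} {σ : Fin m → Fin m} → σ ∈ permutations m → IsInjective σ
permutations-injective {m} σ∈ = proj₂ (∈-filter⁻ injective? {xs = allFuns m m} σ∈)

permutations-complete : ∀ {m} (σ : Fin m → Fin m) → IsInjective σ →
  ∃[ σ′ ] σ′ ∈ permutations m × (∀ i → σ′ i ≡ σ i)
permutations-complete {m} σ σ-inj with σ′ , σ′∈ , σ′≗σ ← allFuns-complete m m σ =
  σ′ , ∈-filter⁺ injective? σ′∈ σ′-inj , σ′≗σ
  where
  σ′-inj : IsInjective σ′
  σ′-inj i j eq = σ-inj i j (trans (sym (σ′≗σ i)) (trans eq (σ′≗σ j)))

prodFin-cong : ∀ {C : Set} (_⊕_ _⊗_ : C → C → C) (𝟘 𝟙 : C) k {f g : Fin k → C} →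
  (∀ i → f i ≡ g i) → prodFin _⊕_ _⊗_ 𝟘 𝟙 k f ≡ prodFin _⊕_ _⊗_ 𝟘 𝟙 k g
prodFin-cong _⊕_ _⊗_ 𝟘 𝟙 zero    f≗g = refl
prodFin-cong _⊕_ _⊗_ 𝟘 𝟙 (suc k) f≗g = cong₂ _⊗_ (f≗g zero) (prodFin-cong _⊕_ _⊗_ 𝟘 𝟙 k (f≗g ∘ suc))

module CycleCovers {n : ℕ} (E : Fin n → Fin n → Set) where
  open import Data.Nat using (_≤_; _<_)
  open import Data.Nat.Properties using (≤-pred; <-≤-trans; n≮0)

  record CycleCover (T : Fin n → Bool) : Set where
    field
      σ          : Fin n → Fin n
      injective  : IsInjective σ
      fixes      : ∀ u → T u ≡ true → σ u ≡ u
      along      : ∀ u → T u ≡ false → E u (σ u)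

    preserves-complement : ∀ u → T u ≡ false → T (σ u) ≡ false
    preserves-complement u Tu with T (σ u) in Tσu
    ... | false = refl
    ... | true with () ← trans (sym Tσu) (trans (cong T (injective (σ u) u (fixes (σ u) Tσu))) Tu)

  PartialMap : Set
  PartialMap = Fin n → Maybe (Fin n)

  _≟ₘ_ : (a b : Maybe (Fin n)) → Dec (a ≡ b)
  _≟ₘ_ = ≡-dec-Maybe _≟_

  Closed : PartialMap → Set
  Closed next = ∀ {u w} → next w ≡ just u → ∃[ v ] next u ≡ just v

  Dangling : PartialMap → Set
  Dangling next = ∃[ x ] ∃[ y ] next x ≡ just y × next y ≡ nothing

  Settled : PartialMap → Fin n → Set
  Settled next u = ∃[ v ] next u ≡ just v × next v ≡ just u

  settled? : ∀ next u → Dec (Settled next u)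
  settled? next u = any? λ v → (next u ≟ₘ just v) ×-dec (next v ≟ₘ just u)

  unsettled : PartialMap → Fin n → Bool
  unsettled next u = not (does (settled? next u))

  record PartialInjection (r : ℕ) : Set where
    field
      next             : PartialMap
      next-injective   : ∀ {u v w} → next u ≡ just w → next v ≡ just w → u ≡ v
      next-along       : ∀ {u v} → next u ≡ just v → E u v
      source           : Fin r → Fin n
      source-injective : IsInjective source
      source-defined   : ∀ a → ∃[ v ] next (source a) ≡ just v

  closed⇒cycleCover : ∀ {r} (p : PartialInjection r) → Closed (PartialInjection.next p) →
    ∃[ T ] CycleCover T × r ≤ count (not ∘ T)
  closed⇒cycleCover {r} p closed = T , cover , injection⇒≤count (not ∘ T) source source-injective source∉T
    where
    open PartialInjection p
    T : Fin n → Bool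
    T u = is-nothing (next u)
    σ : Fin n → Fin n
    σ u = fromMaybe u (next u)
    hit⇒defined : ∀ {u v} → next u ≡ just v → next v ≢ nothing
    hit⇒defined nu nv with c , nv′ ← closed nu with () ← trans (sym nv) nv′
    σ-injective : IsInjective σ
    σ-injective u v σu≡σv with next u in nu | next v in nv
    ... | just a  | just b  = next-injective nu (trans nv (cong just (sym σu≡σv)))
    ... | nothing | nothing = σu≡σv
    ... | just a  | nothing = ⊥-elim (hit⇒defined (trans nu (cong just σu≡σv)) nv)
    ... | nothing | just b  = ⊥-elim (hit⇒defined (trans nv (cong just (sym σu≡σv))) nu)
    σ-fixes : ∀ u → T u ≡ true → σ u ≡ u
    σ-fixes u Tu with next u
    ... | nothing = refl
    σ-along : ∀ u → T u ≡ false → E u (σ u)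
    σ-along u Tu with next u in nu
    ... | just v = next-along nu
    cover : CycleCover T
    cover = record { σ = σ ; injective = σ-injective ; fixes = σ-fixes ; along = σ-along }
    source∉T : ∀ a → not (T (source a)) ≡ true
    source∉T a with v , nv ← source-defined a rewrite nv = refl

  module _ (E-sym : ∀ {u v} → E u v → E v u) where

    -- For a dangling arrow x ↦ y (y has no successor), replace the arrow into x by y ↦ x:
    -- x and y become a 2-cycle, and every 2-cycle of next survives.
    module Redirect {r} (p : PartialInjection r) {x y : Fin n}
                    (x↦y : PartialInjection.next p x ≡ just y)
                    (y↦∅ : PartialInjection.next p y ≡ nothing) where
      open PartialInjection p

      defined≢y : ∀ {u v} → next u ≡ just v → u ≢ y
      defined≢y nu refl with () ← trans (sym nu) y↦∅

      y≢x : y ≢ x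
      y≢x refl = defined≢y x↦y refl

      next′ : PartialMap
      next′ u with u ≟ y
      ... | yes _ = just x
      ... | no _ with next u ≟ₘ just x
      ...   | yes _ = nothing
      ...   | no _  = next u

      next′-y : next′ y ≡ just x
      next′-y with y ≟ y
      ... | yes _ = refl
      ... | no y≢y = ⊥-elim (y≢y refl)

      next′-keeps : ∀ {u v} → next u ≡ just v → v ≢ x → next′ u ≡ just v
      next′-keeps {u} nu v≢x with u ≟ y
      ... | yes u≡y = ⊥-elim (defined≢y nu u≡y)
      ... | no _ with next u ≟ₘ just x
      ...   | yes nu≡x = ⊥-elim (v≢x (just-injective (trans (sym nu) nu≡x)))
      ...   | no _ = nu

      next′-just : ∀ {u v} → next′ u ≡ just v → (u ≡ y × v ≡ x) ⊎ (next u ≡ just v × v ≢ x)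
      next′-just {u} n′u with u ≟ y
      ... | yes u≡y = inj₁ (u≡y , sym (just-injective n′u))
      ... | no _ with next u ≟ₘ just x
      ...   | no nu≢x = inj₂ (n′u , λ { refl → nu≢x n′u })

      next′-injective : ∀ {u v w} → next′ u ≡ just w → next′ v ≡ just w → u ≡ v
      next′-injective {u} {v} n′u n′v with next′-just {u} n′u | next′-just {v} n′v
      ... | inj₁ (u≡y , _)   | inj₁ (v≡y , _)    = trans u≡y (sym v≡y)
      ... | inj₁ (_ , w≡x)   | inj₂ (_ , w≢x)    = ⊥-elim (w≢x w≡x)
      ... | inj₂ (_ , w≢x)   | inj₁ (_ , w≡x)    = ⊥-elim (w≢x w≡x)
      ... | inj₂ (nu , _)    | inj₂ (nv , _)     = next-injective nu nv

      next′-along : ∀ {u v} → next′ u ≡ just v → E u v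
      next′-along {u} n′u with next′-just {u} n′u
      ... | inj₁ (refl , refl) = E-sym (next-along x↦y)
      ... | inj₂ (nu , _)      = next-along nu

      source′ : Fin r → Fin n
      source′ a with next (source a) ≟ₘ just x
      ... | yes _ = y
      ... | no _  = source a

      source′-cases : ∀ a → (next (source a) ≡ just x × source′ a ≡ y)
                          ⊎ (next (source a) ≢ just x × source′ a ≡ source a)
      source′-cases a with next (source a) ≟ₘ just x
      ... | yes ns≡x = inj₁ (ns≡x , refl)
      ... | no ns≢x  = inj₂ (ns≢x , refl)

      source′-injective : IsInjective source′
      source′-injective a b eq with source′-cases a | source′-cases b
      ... | inj₁ (na , _)       | inj₁ (nb , _)       = source-injective a b (next-injective na nb)
      ... | inj₁ (_ , s′a≡y)    | inj₂ (_ , s′b≡sb)   =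
        ⊥-elim (defined≢y (proj₂ (source-defined b)) (trans (sym s′b≡sb) (trans (sym eq) s′a≡y)))
      ... | inj₂ (_ , s′a≡sa)   | inj₁ (_ , s′b≡y)    =
        ⊥-elim (defined≢y (proj₂ (source-defined a)) (trans (sym s′a≡sa) (trans eq s′b≡y)))
      ... | inj₂ (_ , s′a≡sa)   | inj₂ (_ , s′b≡sb)   =
        source-injective a b (trans (sym s′a≡sa) (trans eq s′b≡sb))

      source′-defined : ∀ a → ∃[ v ] next′ (source′ a) ≡ just v
      source′-defined a with source′-cases a | source-defined a
      ... | inj₁ (_ , s′a≡y)    | _ = x , subst (λ z → next′ z ≡ just x) (sym s′a≡y) next′-y
      ... | inj₂ (ns≢x , s′a≡sa) | v , nv =
        v , subst (λ z → next′ z ≡ just v) (sym s′a≡sa) (next′-keeps nv λ { refl → ns≢x nv })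

      redirected : PartialInjection r
      redirected = record
        { next             = next′
        ; next-injective   = next′-injective
        ; next-along       = next′-along
        ; source           = source′
        ; source-injective = source′-injective
        ; source-defined   = source′-defined
        }

      settled≢x : ∀ {u v} → next u ≡ just v → next v ≡ just u → u ≢ x
      settled≢x nu nv refl with refl ← just-injective (trans (sym x↦y) nu) = defined≢y nv refl

      settled-preserved : ∀ u → Settled next u → Settled next′ u
      settled-preserved u (v , nu , nv) =
        v , next′-keeps nu (settled≢x nv nu) , next′-keeps nv (settled≢x nu nv)

      x-settled : Settled next′ x
      x-settled = y , next′-keeps x↦y y≢x , next′-y

      x-unsettled : ¬ Settled next x
      x-unsettled (v , xv , vx) with refl ← just-injective (trans (sym x↦y) xv) = defined≢y vx refl

      unsettled-decreases : count (unsettled next′) < count (unsettled next)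
      unsettled-decreases =
        count-mono-< unsettled-mono x
          (cong not (dec-true (settled? next′ x) x-settled))
          (cong not (dec-false (settled? next x) x-unsettled))
        where
        unsettled-mono : unsettled next′ ⊆ unsettled next
        unsettled-mono u uns′ with settled? next u
        ... | no _ = refl
        ... | yes s
          with () ← trans (sym uns′) (cong not (dec-true (settled? next′ u) (settled-preserved u s)))

    dangling? : ∀ next → Dec (Dangling next)
    dangling? next = any? λ x → any? λ y → (next x ≟ₘ just y) ×-dec (next y ≟ₘ nothing)

    no-dangling⇒closed : ∀ {next} → ¬ Dangling next → Closed next
    no-dangling⇒closed {next} ¬dangling {u} {w} nw with next u in nu
    ... | just v  = v , refl
    ... | nothing = ⊥-elim (¬dangling (w , u , nw , nu))

    close : ∀ {r} fuel (p : PartialInjection r) → count (unsettled (PartialInjection.next p)) ≤ fuel →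
      Σ (PartialInjection r) (Closed ∘ PartialInjection.next)
    close fuel p bound with dangling? (PartialInjection.next p)
    ... | no ¬dangling = p , no-dangling⇒closed ¬dangling
    close zero       p bound | yes (x , y , x↦y , y↦∅) =
      ⊥-elim (n≮0 (<-≤-trans (Redirect.unsettled-decreases p x↦y y↦∅) bound))
    close (suc fuel) p bound | yes (x , y , x↦y , y↦∅) =
      close fuel (Redirect.redirected p x↦y y↦∅)
        (≤-pred (<-≤-trans (Redirect.unsettled-decreases p x↦y y↦∅) bound))

    fromMatching : ∀ {r} (I J : Fin r → Fin n) → IsInjective I → IsInjective J → (∀ a → E (I a) (J a)) →
      PartialInjection r
    fromMatching {r} I J I-inj J-inj edge = record
      { next             = next
      ; next-injective   = next-injective
      ; next-along       = next-along
      ; source           = I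
      ; source-injective = I-inj
      ; source-defined   = λ a → J a , next-I a
      }
      where
      next : PartialMap
      next u with any? (λ a → I a ≟ u)
      ... | yes (a , _) = just (J a)
      ... | no _        = nothing
      next-just : ∀ {u v} → next u ≡ just v → ∃[ a ] I a ≡ u × J a ≡ v
      next-just {u} nu with any? (λ a → I a ≟ u)
      next-just refl | yes (a , Ia≡u) = a , Ia≡u , refl
      next-I : ∀ a → next (I a) ≡ just (J a)
      next-I a with any? (λ b → I b ≟ I a)
      ... | yes (b , Ib≡Ia) = cong (just ∘ J) (I-inj b a Ib≡Ia)
      ... | no ∄b = ⊥-elim (∄b (a , refl))
      next-injective : ∀ {u v w} → next u ≡ just w → next v ≡ just w → u ≡ v
      next-injective nu nv with a , refl , refl ← next-just nu | b , refl , Jb≡Ja ← next-just nv =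
        cong I (J-inj a b (sym Jb≡Ja))
      next-along : ∀ {u v} → next u ≡ just v → E u v
      next-along nu with a , refl , refl ← next-just nu = edge a

    matching⇒cycleCover : ∀ {r} (I J : Fin r → Fin n) → IsInjective I → IsInjective J → (∀ a → E (I a) (J a)) →
      ∃[ T ] CycleCover T × r ≤ count (not ∘ T)
    matching⇒cycleCover I J I-inj J-inj edge =
      let p , closed = close n (fromMatching I J I-inj J-inj edge) (count-≤ _)
      in closed⇒cycleCover p closed

open CycleCovers

module _ (Rf : RealField) where
  open RealField Rf
  open OverReals Rf
  open IsTotalOrder isTotalOrder using (antisym; total) renaming (trans to ≤-trans; refl to ≤-refl)

  private
    commutativeRing : CommutativeRing 0ℓ 0ℓ
    commutativeRing = record
      { Carrier = ℝ ; _≈_ = _≡_ ; _+_ = _+_ ; _*_ = _*_ ; -_ = -_ ; 0# = 0# ; 1# = 1#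
      ; isCommutativeRing = isCommutativeRing }

  open CommutativeRing commutativeRing
    using (+-identityˡ; +-identityʳ; *-identityʳ; zeroˡ; zeroʳ; *-assoc; +-comm; -‿inverseˡ)
  open RingProperties (CommutativeRing.ring commutativeRing)
    using (-‿distribʳ-*; -‿involutive; -‿+-comm; -0#≈0#; -1*x≈-x)

  *-≢0 : ∀ {x y} → x ≢ 0# → y ≢ 0# → x * y ≢ 0#
  *-≢0 {x} {y} x≢0 y≢0 xy≡0 with y⁻¹ , yy⁻¹≡1 ← inverse y y≢0 = x≢0 (begin
    x            ≡⟨ sym (*-identityʳ x) ⟩
    x * 1#       ≡⟨ cong (x *_) (sym yy⁻¹≡1) ⟩
    x * (y * y⁻¹) ≡⟨ sym (*-assoc x y y⁻¹) ⟩
    x * y * y⁻¹  ≡⟨ cong (_* y⁻¹) xy≡0 ⟩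
    0# * y⁻¹     ≡⟨ zeroˡ y⁻¹ ⟩
    0#           ∎)
    where open ≡-Reasoning

  *-≢0⇒ˡ : ∀ {x y} → x * y ≢ 0# → x ≢ 0#
  *-≢0⇒ˡ {y = y} xy≢0 refl = xy≢0 (zeroˡ y)

  *-≢0⇒ʳ : ∀ {x y} → x * y ≢ 0# → y ≢ 0#
  *-≢0⇒ʳ {x} xy≢0 refl = xy≢0 (zeroʳ x)

  +-nonneg : ∀ {x y} → 0# ≤ x → 0# ≤ y → 0# ≤ x + y
  +-nonneg {x} {y} 0≤x 0≤y = ≤-trans 0≤y (subst (_≤ x + y) (+-identityˡ y) (+-mono-≤ y 0≤x))

  +-≢0ˡ : ∀ {x y} → 0# ≤ x → 0# ≤ y → x ≢ 0# → x + y ≢ 0#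
  +-≢0ˡ {x} {y} 0≤x 0≤y x≢0 x+y≡0 = x≢0 (antisym (subst (x ≤_) x+y≡0 x≤x+y) 0≤x)
    where
    x≤x+y : x ≤ x + y
    x≤x+y = subst₂ _≤_ (+-identityˡ x) (+-comm y x) (+-mono-≤ x 0≤y)

  +-≢0ʳ : ∀ {x y} → 0# ≤ x → 0# ≤ y → y ≢ 0# → x + y ≢ 0#
  +-≢0ʳ {x} {y} 0≤x 0≤y y≢0 x+y≡0 = +-≢0ˡ 0≤y 0≤x y≢0 (trans (+-comm y x) x+y≡0)

  0≤1 : 0# ≤ 1#
  0≤1 with total 0# 1#
  ... | inj₁ 0≤1 = 0≤1
  ... | inj₂ 1≤0 = subst (0# ≤_) (-1*-1≡1) (*-nonneg 0≤-1 0≤-1)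
    where
    0≤-1 : 0# ≤ - 1#
    0≤-1 = subst₂ _≤_ (trans (+-comm 1# (- 1#)) (-‿inverseˡ 1#)) (+-identityˡ (- 1#)) (+-mono-≤ (- 1#) 1≤0)
    -1*-1≡1 : - 1# * - 1# ≡ 1#
    -1*-1≡1 = trans (-1*x≈-x (- 1#)) (-‿involutive 1#)

  negateⁿ : ℕ → ℝ → ℝ
  negateⁿ zero    x = x
  negateⁿ (suc k) x = - negateⁿ k x

  negateⁿ-0# : ∀ k → negateⁿ k 0# ≡ 0#
  negateⁿ-0# zero    = refl
  negateⁿ-0# (suc k) = trans (cong -_ (negateⁿ-0# k)) -0#≈0#

  negateⁿ≡0⇒ : ∀ k {x} → negateⁿ k x ≡ 0# → x ≡ 0#
  negateⁿ≡0⇒ zero    eq = eq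
  negateⁿ≡0⇒ (suc k) eq = negateⁿ≡0⇒ k (trans (sym (-‿involutive _)) (trans (cong -_ eq) -0#≈0#))

  negateⁿ-+ : ∀ k x y → negateⁿ k (x + y) ≡ negateⁿ k x + negateⁿ k y
  negateⁿ-+ zero    x y = refl
  negateⁿ-+ (suc k) x y = trans (cong -_ (negateⁿ-+ k x y)) (sym (-‿+-comm _ _))

  negateⁿ-*ˡ : ∀ k a x → negateⁿ k (a * x) ≡ a * negateⁿ k x
  negateⁿ-*ˡ zero    a x = refl
  negateⁿ-*ˡ (suc k) a x = trans (cong -_ (negateⁿ-*ˡ k a x)) (-‿distribʳ-* a _)

  negateⁿ-‿ : ∀ k x → negateⁿ k (- x) ≡ - negateⁿ k x
  negateⁿ-‿ zero    x = refl
  negateⁿ-‿ (suc k) x = cong -_ (negateⁿ-‿ k x)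

  ∑ : ∀ {X : Set} → List X → (X → ℝ) → ℝ
  ∑ xs F = foldr _+_ 0# (map F xs)

  ∑-cong : ∀ {X : Set} (xs : List X) {F G : X → ℝ} → (∀ x → F x ≡ G x) → ∑ xs F ≡ ∑ xs G
  ∑-cong []       F≗G = refl
  ∑-cong (x ∷ xs) F≗G = cong₂ _+_ (F≗G x) (∑-cong xs F≗G)

  ∑-nonneg : ∀ {X : Set} (xs : List X) {F : X → ℝ} → (∀ x → 0# ≤ F x) → 0# ≤ ∑ xs F
  ∑-nonneg []       F≥0 = ≤-refl
  ∑-nonneg (x ∷ xs) F≥0 = +-nonneg (F≥0 x) (∑-nonneg xs F≥0)

  ∑-≢0 : ∀ {X : Set} (xs : List X) {F : X → ℝ} → (∀ x → 0# ≤ F x) → ∀ {x} → x ∈ xs → F x ≢ 0# → ∑ xs F ≢ 0#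
  ∑-≢0 (y ∷ xs) F≥0 (here refl) Fx≢0 = +-≢0ˡ (F≥0 y) (∑-nonneg xs F≥0) Fx≢0
  ∑-≢0 (y ∷ xs) F≥0 (there x∈)  Fx≢0 = +-≢0ʳ (F≥0 y) (∑-nonneg xs F≥0) (∑-≢0 xs F≥0 x∈ Fx≢0)

  ∑≢0⇒ : ∀ {X : Set} (xs : List X) {F : X → ℝ} → ∑ xs F ≢ 0# → ¬ ¬ (∃[ x ] x ∈ xs × F x ≢ 0#)
  ∑≢0⇒ []       ∑≢0 = ⊥-elim (∑≢0 refl)
  ∑≢0⇒ (x ∷ xs) {F} ∑≢0 = ¬¬-excluded-middle >>= λ where
    (no Fx≢0)  → pure (x , here refl , Fx≢0)
    (yes Fx≡0) → (λ (y , y∈ , Fy≢0) → y , there y∈ , Fy≢0) <$>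
      ∑≢0⇒ xs λ rest≡0 → ∑≢0 (trans (cong₂ _+_ Fx≡0 rest≡0) (+-identityˡ 0#))

  ∏ : (k : ℕ) → (Fin k → ℝ) → ℝ
  ∏ = prodFin _+_ _*_ 0# 1#

  ∏-nonneg : ∀ k {f : Fin k → ℝ} → (∀ i → 0# ≤ f i) → 0# ≤ ∏ k f
  ∏-nonneg zero    f≥0 = 0≤1
  ∏-nonneg (suc k) f≥0 = *-nonneg (f≥0 zero) (∏-nonneg k (f≥0 ∘ suc))

  ∏-≢0 : ∀ k {f : Fin k → ℝ} → (∀ i → f i ≢ 0#) → ∏ k f ≢ 0#
  ∏-≢0 zero    f≢0 = 0≢1 ∘ sym
  ∏-≢0 (suc k) f≢0 = *-≢0 (f≢0 zero) (∏-≢0 k (f≢0 ∘ suc))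

  ∏≢0⇒ : ∀ k {f : Fin k → ℝ} → ∏ k f ≢ 0# → ∀ i → f i ≢ 0#
  ∏≢0⇒ (suc k) ∏≢0 zero    = *-≢0⇒ˡ ∏≢0
  ∏≢0⇒ (suc k) ∏≢0 (suc i) = ∏≢0⇒ k (*-≢0⇒ʳ ∏≢0) i

  per-≢0 : ∀ {m} (B : Fin m → Fin m → ℝ) → (∀ i j → 0# ≤ B i j) →
    (τ : Fin m → Fin m) → IsInjective τ → (∀ a → B a (τ a) ≢ 0#) → per m B ≢ 0#
  per-≢0 {m} B B≥0 τ τ-inj Bτ≢0 with τ′ , τ′∈ , τ′≗τ ← permutations-complete τ τ-inj =
    ∑-≢0 (permutations m) (λ σ → ∏-nonneg m (λ i → B≥0 i (σ i))) τ′∈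
      (∏-≢0 m λ i → subst (λ j → B i j ≢ 0#) (sym (τ′≗τ i)) (Bτ≢0 i))

  per≢0⇒transversal : ∀ {m} (B : Fin m → Fin m → ℝ) → per m B ≢ 0# →
    ¬ ¬ (∃[ τ ] IsInjective τ × (∀ a → B a (τ a) ≢ 0#))
  per≢0⇒transversal {m} B per≢0 =
    (λ (τ , τ∈ , ∏≢0) → τ , permutations-injective τ∈ , ∏≢0⇒ m ∏≢0) <$> ∑≢0⇒ (permutations m) per≢0

  coeff-+ₚ : ∀ p q k → coeff (p +ₚ q) k ≡ coeff p k + coeff q k
  coeff-+ₚ []      q       k       = sym (+-identityˡ _)
  coeff-+ₚ (a ∷ p) []      k       = sym (+-identityʳ _)
  coeff-+ₚ (a ∷ p) (b ∷ q) zero    = refl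
  coeff-+ₚ (a ∷ p) (b ∷ q) (suc k) = coeff-+ₚ p q k

  coeff-scale : ∀ a q k → coeff (scale a q) k ≡ a * coeff q k
  coeff-scale a []      k       = sym (zeroʳ a)
  coeff-scale a (b ∷ q) zero    = refl
  coeff-scale a (b ∷ q) (suc k) = coeff-scale a q k

  coeff-0# : ∀ k → coeff (0# ∷ []) k ≡ 0#
  coeff-0# zero    = refl
  coeff-0# (suc k) = refl

  coeff-∑ₚ : ∀ {X : Set} (xs : List X) (G : X → Poly) k →
    coeff (foldr _+ₚ_ [] (map G xs)) k ≡ ∑ xs (λ x → coeff (G x) k)
  coeff-∑ₚ []       G k = refl
  coeff-∑ₚ (x ∷ xs) G k = trans (coeff-+ₚ (G x) _ k) (cong (coeff (G x) k +_) (coeff-∑ₚ xs G k))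

  -- (−1)^k times the coefficient of x^k: nonnegative for every product of factors b − x and b with b ≥ 0.
  signedCoeff : ℕ → Poly → ℝ
  signedCoeff k p = negateⁿ k (coeff p k)

  signedCoeff-∑ₚ : ∀ {X : Set} (xs : List X) (G : X → Poly) k →
    signedCoeff k (foldr _+ₚ_ [] (map G xs)) ≡ ∑ xs (λ x → signedCoeff k (G x))
  signedCoeff-∑ₚ xs G k = trans (cong (negateⁿ k) (coeff-∑ₚ xs G k)) (negateⁿ-∑ xs)
    where
    negateⁿ-∑ : ∀ {X : Set} (xs : List X) {F : X → ℝ} → negateⁿ k (∑ xs F) ≡ ∑ xs (negateⁿ k ∘ F)
    negateⁿ-∑ []       = negateⁿ-0# k
    negateⁿ-∑ (x ∷ xs) = trans (negateⁿ-+ k _ _) (cong (_ +_) (negateⁿ-∑ xs))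

  factor : Bool → ℝ → Poly
  factor false b = b ∷ []
  factor true  b = b ∷ - 1# ∷ []

  coeff-const : ∀ b q k → coeff (factor false b *ₚ q) k ≡ b * coeff q k
  coeff-const b q k =
    trans (coeff-+ₚ (scale b q) _ k) (trans (cong₂ _+_ (coeff-scale b q k) (coeff-0# k)) (+-identityʳ _))

  signedCoeff-const : ∀ b q k → signedCoeff k (factor false b *ₚ q) ≡ b * signedCoeff k q
  signedCoeff-const b q k = trans (cong (negateⁿ k) (coeff-const b q k)) (negateⁿ-*ˡ k b _)

  signedCoeff-linear-zero : ∀ b q → signedCoeff 0 (factor true b *ₚ q) ≡ b * signedCoeff 0 q
  signedCoeff-linear-zero b q = trans (coeff-+ₚ (scale b q) _ 0) (trans (+-identityʳ _) (coeff-scale b q 0))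

  signedCoeff-linear-suc : ∀ b q k →
    signedCoeff (suc k) (factor true b *ₚ q) ≡ b * signedCoeff (suc k) q + signedCoeff k q
  signedCoeff-linear-suc b q k = begin
    negateⁿ (suc k) (coeff (factor true b *ₚ q) (suc k))
      ≡⟨ cong (negateⁿ (suc k)) (coeff-+ₚ (scale b q) _ (suc k)) ⟩
    negateⁿ (suc k) (coeff (scale b q) (suc k) + coeff ((- 1# ∷ []) *ₚ q) k)
      ≡⟨ cong (λ z → negateⁿ (suc k) (coeff (scale b q) (suc k) + z)) (coeff-const (- 1#) q k) ⟩
    negateⁿ (suc k) (coeff (scale b q) (suc k) + - 1# * coeff q k)
      ≡⟨ cong₂ (λ u v → negateⁿ (suc k) (u + v)) (coeff-scale b q (suc k)) (-1*x≈-x _) ⟩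
    negateⁿ (suc k) (b * coeff q (suc k) + - coeff q k)
      ≡⟨ negateⁿ-+ (suc k) _ _ ⟩
    negateⁿ (suc k) (b * coeff q (suc k)) + negateⁿ (suc k) (- coeff q k)
      ≡⟨ cong₂ _+_ (negateⁿ-*ˡ (suc k) b _) (trans (cong -_ (negateⁿ-‿ k _)) (-‿involutive _)) ⟩
    b * signedCoeff (suc k) q + signedCoeff k q
      ∎
    where open ≡-Reasoning

  linearProduct : ∀ {m} → (Fin m → Bool) → (Fin m → ℝ) → Poly
  linearProduct {m} d b = prodFin _+ₚ_ _*ₚ_ [] (1# ∷ []) m (λ i → factor (d i) (b i))

  -- T marks the factors b i − x from which −x is taken; every other factor contributes b i.
  Admissible : ∀ {m} → (Fin m → Bool) → (Fin m → ℝ) → (Fin m → Bool) → Set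
  Admissible d b T = T ⊆ d × (∀ i → T i ≡ false → b i ≢ 0#)

  signedCoeff-factor-nonneg : ∀ d {b q} → 0# ≤ b → (∀ k → 0# ≤ signedCoeff k q) →
    ∀ k → 0# ≤ signedCoeff k (factor d b *ₚ q)
  signedCoeff-factor-nonneg false {b} {q} b≥0 q≥0 k =
    subst (0# ≤_) (sym (signedCoeff-const b q k)) (*-nonneg b≥0 (q≥0 k))
  signedCoeff-factor-nonneg true  {b} {q} b≥0 q≥0 zero =
    subst (0# ≤_) (sym (signedCoeff-linear-zero b q)) (*-nonneg b≥0 (q≥0 zero))
  signedCoeff-factor-nonneg true  {b} {q} b≥0 q≥0 (suc k) =
    subst (0# ≤_) (sym (signedCoeff-linear-suc b q k)) (+-nonneg (*-nonneg b≥0 (q≥0 (suc k))) (q≥0 k))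

  signedCoeff-factor-≢0 : ∀ d b q k → 0# ≤ b → (∀ j → 0# ≤ signedCoeff j q) →
    b ≢ 0# → signedCoeff k q ≢ 0# → signedCoeff k (factor d b *ₚ q) ≢ 0#
  signedCoeff-factor-≢0 false b q k b≥0 q≥0 b≢0 q≢0 =
    *-≢0 b≢0 q≢0 ∘ trans (sym (signedCoeff-const b q k))
  signedCoeff-factor-≢0 true  b q zero b≥0 q≥0 b≢0 q≢0 =
    *-≢0 b≢0 q≢0 ∘ trans (sym (signedCoeff-linear-zero b q))
  signedCoeff-factor-≢0 true  b q (suc k) b≥0 q≥0 b≢0 q≢0 =
    +-≢0ˡ (*-nonneg b≥0 (q≥0 (suc k))) (q≥0 k) (*-≢0 b≢0 q≢0) ∘ trans (sym (signedCoeff-linear-suc b q k))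

  signedCoeff-linear-≢0 : ∀ b q k → 0# ≤ b → (∀ j → 0# ≤ signedCoeff j q) →
    signedCoeff k q ≢ 0# → signedCoeff (suc k) (factor true b *ₚ q) ≢ 0#
  signedCoeff-linear-≢0 b q k b≥0 q≥0 q≢0 =
    +-≢0ʳ (*-nonneg b≥0 (q≥0 (suc k))) (q≥0 k) q≢0 ∘ trans (sym (signedCoeff-linear-suc b q k))

  signedCoeff-linearProduct-nonneg : ∀ {m} (d : Fin m → Bool) {b : Fin m → ℝ} → (∀ i → 0# ≤ b i) →
    ∀ k → 0# ≤ signedCoeff k (linearProduct d b)
  signedCoeff-linearProduct-nonneg {zero}  d b≥0 zero    = 0≤1
  signedCoeff-linearProduct-nonneg {zero}  d b≥0 (suc k) = subst (0# ≤_) (sym (negateⁿ-0# (suc k))) ≤-refl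
  signedCoeff-linearProduct-nonneg {suc m} d b≥0 =
    signedCoeff-factor-nonneg (d zero) (b≥0 zero) (signedCoeff-linearProduct-nonneg (tail d) (b≥0 ∘ suc))

  signedCoeff-linearProduct-≢0 : ∀ {m} (d : Fin m → Bool) {b : Fin m → ℝ} → (∀ i → 0# ≤ b i) →
    ∀ T → Admissible d b T → signedCoeff (count T) (linearProduct d b) ≢ 0#
  signedCoeff-linearProduct-≢0 {zero}  d b≥0 T _ = 0≢1 ∘ sym
  signedCoeff-linearProduct-≢0 {suc m} d {b} b≥0 T (T⊆d , b≢0) with T zero in T0
  ... | true rewrite T⊆d zero T0 = signedCoeff-linear-≢0 (b zero) q (count (tail T)) (b≥0 zero) q≥0 q≢0
    where
    q = linearProduct (tail d) (tail b)
    q≥0 = signedCoeff-linearProduct-nonneg (tail d) (b≥0 ∘ suc)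
    q≢0 = signedCoeff-linearProduct-≢0 (tail d) (b≥0 ∘ suc) (tail T) (T⊆d ∘ suc , b≢0 ∘ suc)
  ... | false = signedCoeff-factor-≢0 (d zero) (b zero) q (count (tail T)) (b≥0 zero) q≥0 (b≢0 zero T0) q≢0
    where
    q = linearProduct (tail d) (tail b)
    q≥0 = signedCoeff-linearProduct-nonneg (tail d) (b≥0 ∘ suc)
    q≢0 = signedCoeff-linearProduct-≢0 (tail d) (b≥0 ∘ suc) (tail T) (T⊆d ∘ suc , b≢0 ∘ suc)

  admissible-skip : ∀ {m} {d : Fin (suc m) → Bool} {b : Fin (suc m) → ℝ} {k} → b zero ≢ 0# →
    ∃[ T ] Admissible (tail d) (tail b) T × count T ≡ k → ∃[ T ] Admissible d b T × count T ≡ k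
  admissible-skip b₀≢0 (T , (T⊆d , b≢0) , count≡k) =
    false Vec.∷ T , ((λ { (suc i) → T⊆d i }) , (λ { zero _ → b₀≢0 ; (suc i) → b≢0 i })) , count≡k

  admissible-take : ∀ {m} {d : Fin (suc m) → Bool} {b : Fin (suc m) → ℝ} {k} → d zero ≡ true →
    ∃[ T ] Admissible (tail d) (tail b) T × count T ≡ k → ∃[ T ] Admissible d b T × count T ≡ suc k
  admissible-take d₀ (T , (T⊆d , b≢0) , count≡k) =
    true Vec.∷ T , ((λ { zero _ → d₀ ; (suc i) → T⊆d i }) , (λ { (suc i) → b≢0 i })) , cong suc count≡k

  signedCoeff-linearProduct≢0⇒ : ∀ {m} (d : Fin m → Bool) (b : Fin m → ℝ) k →
    signedCoeff k (linearProduct d b) ≢ 0# → ¬ ¬ (∃[ T ] Admissible d b T × count T ≡ k)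
  signedCoeff-linearProduct≢0⇒ {zero} d b zero _ = pure ((λ ()) , ((λ ()) , (λ ())) , refl)
  signedCoeff-linearProduct≢0⇒ {zero} d b (suc k) c≢0 = ⊥-elim (c≢0 (negateⁿ-0# (suc k)))
  signedCoeff-linearProduct≢0⇒ {suc m} d b k c≢0 with d zero in d₀
  ... | false =
    admissible-skip (*-≢0⇒ˡ b₀c≢0) <$> signedCoeff-linearProduct≢0⇒ (tail d) (tail b) k (*-≢0⇒ʳ b₀c≢0)
    where b₀c≢0 = c≢0 ∘ trans (signedCoeff-const (b zero) (linearProduct (tail d) (tail b)) k)
  signedCoeff-linearProduct≢0⇒ {suc m} d b zero c≢0 | true =
    admissible-skip (*-≢0⇒ˡ b₀c≢0) <$> signedCoeff-linearProduct≢0⇒ (tail d) (tail b) zero (*-≢0⇒ʳ b₀c≢0)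
    where b₀c≢0 = c≢0 ∘ trans (signedCoeff-linear-zero (b zero) (linearProduct (tail d) (tail b)))
  signedCoeff-linearProduct≢0⇒ {suc m} d b (suc k) c≢0 | true = ¬¬-excluded-middle >>= λ where
      (no  cₖ≢0) → admissible-take d₀ <$> signedCoeff-linearProduct≢0⇒ (tail d) (tail b) k cₖ≢0
      (yes cₖ≡0) →
        let b₀c≢0 = λ b₀c≡0 → c≢0 (trans (signedCoeff-linear-suc (b zero) q k)
                                   (trans (cong₂ _+_ b₀c≡0 cₖ≡0) (+-identityˡ 0#)))
        in admissible-skip (*-≢0⇒ˡ b₀c≢0) <$>
             signedCoeff-linearProduct≢0⇒ (tail d) (tail b) (suc k) (*-≢0⇒ʳ b₀c≢0)
    where q = linearProduct (tail d) (tail b)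

  module _ {n} (A : Matrix n) where

    NonzeroEntry : Fin n → Fin n → Set
    NonzeroEntry u v = A u v ≢ 0#

    permTerm : (Fin n → Fin n) → Poly
    permTerm σ = linearProduct (λ i → does (i ≟ σ i)) (λ i → A i (σ i))

    permTerm-cong : ∀ {σ τ} → (∀ i → σ i ≡ τ i) → permTerm σ ≡ permTerm τ
    permTerm-cong σ≗τ = prodFin-cong _+ₚ_ _*ₚ_ [] (1# ∷ []) n λ i →
      cong (λ j → factor (does (i ≟ j)) (A i j)) (σ≗τ i)

    signedCoeff-permPoly : ∀ k → signedCoeff k (permPoly A) ≡ ∑ (permutations n) (signedCoeff k ∘ permTerm)
    signedCoeff-permPoly k = trans (signedCoeff-∑ₚ (permutations n) _ k)
      (∑-cong (permutations n) λ σ →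
        cong (signedCoeff k) (prodFin-cong _+ₚ_ _*ₚ_ [] (1# ∷ []) n λ i → A-xI≡factor i (σ i)))
      where
      A-xI≡factor : ∀ i j → A-xI A i j ≡ factor (does (i ≟ j)) (A i j)
      A-xI≡factor i j with i ≟ j
      ... | yes _ = refl
      ... | no _  = refl

    cycleCover⇒admissible : ∀ {T} (c : CycleCover NonzeroEntry T) →
      Admissible (λ i → does (i ≟ CycleCover.σ c i)) (λ i → A i (CycleCover.σ c i)) T
    cycleCover⇒admissible c = (λ u Tu → dec-true (u ≟ σ u) (sym (fixes u Tu))) , along
      where open CycleCover c

    admissible⇒cycleCover : ∀ {σ T} → IsInjective σ → Admissible (λ i → does (i ≟ σ i)) (λ i → A i (σ i)) T →
      CycleCover NonzeroEntry T
    admissible⇒cycleCover {σ} {T} σ-inj (T⊆fix , off-T≢0) =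
      record { σ = σ ; injective = σ-inj ; fixes = fixes ; along = off-T≢0 }
      where
      fixes : ∀ u → T u ≡ true → σ u ≡ u
      fixes u Tu with u ≟ σ u | T⊆fix u Tu
      ... | yes u≡σu | _  = sym u≡σu
      ... | no _     | ()

    permTerm-≢0⇒coeff-permPoly-≢0 : Nonnegative A → ∀ {k σ} → IsInjective σ →
      signedCoeff k (permTerm σ) ≢ 0# → coeff (permPoly A) k ≢ 0#
    permTerm-≢0⇒coeff-permPoly-≢0 A≥0 {k} {σ} σ-inj term≢0 coeff≡0
      with σ′ , σ′∈ , σ′≗σ ← permutations-complete σ σ-inj =
      ∑-≢0 (permutations n) (λ τ → signedCoeff-linearProduct-nonneg _ (λ i → A≥0 i (τ i)) k) σ′∈
        (subst (λ p → signedCoeff k p ≢ 0#) (sym (permTerm-cong σ′≗σ)) term≢0)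
        (trans (sym (signedCoeff-permPoly k)) (trans (cong (negateⁿ k) coeff≡0) (negateⁿ-0# k)))

    coeff-permPoly-≢0 : Nonnegative A → ∀ {T} → CycleCover NonzeroEntry T → coeff (permPoly A) (count T) ≢ 0#
    coeff-permPoly-≢0 A≥0 {T} c = permTerm-≢0⇒coeff-permPoly-≢0 A≥0 injective
      (signedCoeff-linearProduct-≢0 _ (λ i → A≥0 i (σ i)) T (cycleCover⇒admissible c))
      where open CycleCover c

    coeff-permPoly≢0⇒ : ∀ {k} → coeff (permPoly A) k ≢ 0# →
      ¬ ¬ (∃[ T ] CycleCover NonzeroEntry T × count T ≡ k)
    coeff-permPoly≢0⇒ {k} coeff≢0 = do
      (σ , σ∈ , term≢0) ← ∑≢0⇒ (permutations n) (coeff≢0 ∘ negateⁿ≡0⇒ k ∘ trans (signedCoeff-permPoly k))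
      (T , admissible , count≡k) ← signedCoeff-linearProduct≢0⇒ _ _ k term≢0
      pure (T , admissible⇒cycleCover (permutations-injective σ∈) admissible , count≡k)

    cycleCover⇒principalPer≢0 : Nonnegative A → ∀ {T} → CycleCover NonzeroEntry T →
      per (count (not ∘ T)) (sub A (enum (not ∘ T)) (enum (not ∘ T))) ≢ 0#
    cycleCover⇒principalPer≢0 A≥0 {T} c =
      per-≢0 _ (λ a b → A≥0 (I a) (I b)) τ τ-injective
        (λ a → subst (NonzeroEntry (I a)) (sym (Iτ≡σI a)) (along (I a) (I∉T a)))
      where
      open CycleCover c
      I = enum (not ∘ T)
      I∉T : ∀ a → T (I a) ≡ false
      I∉T a = not-injective (enum-∈ (not ∘ T) a)
      τ-spec : ∀ a → ∃[ b ] I b ≡ σ (I a)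
      τ-spec a = enum-surjective (not ∘ T) (σ (I a)) (cong not (preserves-complement (I a) (I∉T a)))
      τ : Fin (count (not ∘ T)) → Fin (count (not ∘ T))
      τ a = proj₁ (τ-spec a)
      Iτ≡σI : ∀ a → I (τ a) ≡ σ (I a)
      Iτ≡σI a = proj₂ (τ-spec a)
      τ-injective : IsInjective τ
      τ-injective a b τa≡τb = enum-injective (not ∘ T) a b
        (injective (I a) (I b) (trans (sym (Iτ≡σI a)) (trans (cong I τa≡τb) (Iτ≡σI b))))

    permRank-maximal : ∀ {r k} → IsPermRank A r → (I J : Fin k → Fin n) →
      StrictlyIncreasing I → StrictlyIncreasing J → per k (sub A I J) ≢ 0# → k ℕ.≤ r
    permRank-maximal (_ , larger≡0) I J I↑ J↑ per≢0 = ℕ.≮⇒≥ λ r<k → per≢0 (larger≡0 _ r<k I J I↑ J↑)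

    permNullity-minimal : ∀ {e k} → IsPermNullity A e → coeff (permPoly A) k ≢ 0# → e ℕ.≤ k
    permNullity-minimal (lower≡0 , _) coeff≢0 = ℕ.≮⇒≥ λ k<e → coeff≢0 (lower≡0 _ k<e)

    n≤rank+nullity : Nonnegative A → ∀ {r e} → IsPermRank A r → IsPermNullity A e → ¬ ¬ (n ℕ.≤ r ℕ.+ e)
    n≤rank+nullity A≥0 {r} {e} rank (_ , coeff-e≢0) = do
      (T , cover , count≡e) ← coeff-permPoly≢0⇒ coeff-e≢0
      let ∁T = not ∘ T
          ∁T≤r = permRank-maximal rank (enum ∁T) (enum ∁T)
                   (enum-strictlyIncreasing ∁T) (enum-strictlyIncreasing ∁T)
                   (cycleCover⇒principalPer≢0 A≥0 cover)
      pure (begin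
        n                   ≡⟨ sym (count-complement T) ⟩
        count T ℕ.+ count ∁T ≤⟨ ℕ.+-mono-≤ (ℕ.≤-reflexive count≡e) ∁T≤r ⟩
        e ℕ.+ r             ≡⟨ ℕ.+-comm e r ⟩
        r ℕ.+ e             ∎)
      where open ℕ.≤-Reasoning

    rank+nullity≤n : Symmetric A → Nonnegative A → ∀ {r e} → IsPermRank A r → IsPermNullity A e →
      ¬ ¬ (r ℕ.+ e ℕ.≤ n)
    rank+nullity≤n A-sym A≥0 {r} {e} ((I , J , I↑ , J↑ , per≢0) , _) nullity = do
      (τ , τ-inj , τ-nonzero) ← per≢0⇒transversal (sub A I J) per≢0
      let T , cover , r≤∁T = matching⇒cycleCover NonzeroEntry nonzero-sym I (J ∘ τ)
                               (strictlyIncreasing⇒injective I↑)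
                               (λ a b → τ-inj a b ∘ strictlyIncreasing⇒injective J↑ (τ a) (τ b))
                               τ-nonzero
          e≤T = permNullity-minimal nullity (coeff-permPoly-≢0 A≥0 cover)
      pure (begin
        r ℕ.+ e                   ≤⟨ ℕ.+-mono-≤ r≤∁T e≤T ⟩
        count (not ∘ T) ℕ.+ count T ≡⟨ ℕ.+-comm _ (count T) ⟩
        count T ℕ.+ count (not ∘ T) ≡⟨ count-complement T ⟩
        n                         ∎)
      where
      open ℕ.≤-Reasoning
      nonzero-sym : ∀ {u v} → NonzeroEntry u v → NonzeroEntry v u
      nonzero-sym {u} {v} Auv≢0 Avu≡0 = Auv≢0 (trans (A-sym u v) Avu≡0)

-- Only here, outside the field's scope, does _+_ denote addition of naturals.
open import Data.Nat using (_+_)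

theorem3 : (Rf : RealField) (n : ℕ) (A : OverReals.Matrix Rf n) →
    OverReals.Symmetric Rf A → OverReals.Nonnegative Rf A →
    (r e : ℕ) → OverReals.IsPermRank Rf A r → OverReals.IsPermNullity Rf A e →
    r + e ≡ n
theorem3 Rf n A A-sym A≥0 r e rank nullity = decidable-stable (r + e ℕ.≟ n) do
  n≤r+e ← n≤rank+nullity Rf A A≥0 rank nullity
  r+e≤n ← rank+nullity≤n Rf A A-sym A≥0 rank nullity
  pure (ℕ.≤-antisym r+e≤n n≤r+e)
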